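{- Let $k \ge 4$ and let $G$ be an $SQSR(n, k, 0; k-1, k-2, k-3)$ graph. Then $n - k - 1 \geq k$ (i.e. for any vertex $u$, the graph $G - N[u]$ has at least $k$ vertices).
   Context: All graphs are finite and simple. $N[u]$ is the closed neighbourhood of $u$. A $QSR(n,k,a;c_1,\ldots,c_p)$ graph is a $k$-regular graph on $n$ vertices such that any two adjacent vertices have exactly $a$ common neighbours and any two distinct non-adjacent vertices have exactly $c_i$ common neighbours for some $1 \le i \le p$. Its grade is the number of indices $i$ for which there actually exist two non-adjacent vertices with exactly $c_i$ common neighbours; it is proper if its grade is $p$. An $SQSR(n,k,a;c_1,\ldots,c_p)$ graph is a proper $QSR(n,k,a;c_1,\ldots,c_p)$ graph in which $a, c_1, \ldots, c_p$ are pairwise distinct. -}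

module Defs where

open import Data.Nat using (ℕ; _+_; _∸_)
open import Data.Fin using (Fin)
open import Data.Fin.Subset using (Subset; ∣_∣; _∩_)
open import Data.Vec using (tabulate)
open import Data.Product using (_×_; ∃-syntax)
open import Relation.Nullary using (¬_; Dec; does)
open import Relation.Binary.PropositionalEquality using (_≡_)
open import Level using (0ℓ; suc)

record SimpleGraph (n : ℕ) : Set₁ where
  field
    Adj      : Fin n → Fin n → Set
    adj?     : (u v : Fin n) → Dec (Adj u v)
    symm     : ∀ {u v} → Adj u v → Adj v u
    irrefl   : ∀ {u} → ¬ Adj u u

open SimpleGraph public

nbhd : ∀ {n} → SimpleGraph n → Fin n → Subset n
nbhd G u = tabulate (λ v → does (adj? G u v))

degree : ∀ {n} → SimpleGraph n → Fin n → ℕ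
degree G u = ∣ nbhd G u ∣

commonNbrs : ∀ {n} → SimpleGraph n → Fin n → Fin n → ℕ
commonNbrs G u v = ∣ nbhd G u ∩ nbhd G v ∣

IsRegular : ∀ {n} → SimpleGraph n → ℕ → Set
IsRegular G k = ∀ u → degree G u ≡ k

NonAdjPair : ∀ {n} → SimpleGraph n → Fin n → Fin n → Set
NonAdjPair G u v = ¬ u ≡ v × ¬ Adj G u v

IsQSR3 : ∀ {n} → SimpleGraph n → (k a c₁ c₂ c₃ : ℕ) → Set
IsQSR3 G k a c₁ c₂ c₃ =
  IsRegular G k ×
  (∀ u v → Adj G u v → commonNbrs G u v ≡ a) ×
  (∀ u v → NonAdjPair G u v →
     (commonNbrs G u v ≡ c₁) ⊎′ ((commonNbrs G u v ≡ c₂) ⊎′ (commonNbrs G u v ≡ c₃)))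
  where
  open import Data.Sum using () renaming (_⊎_ to _⊎′_)

Realised : ∀ {n} → SimpleGraph n → ℕ → Set
Realised G c = ∃[ u ] ∃[ v ] (NonAdjPair G u v × commonNbrs G u v ≡ c)

IsProperQSR3 : ∀ {n} → SimpleGraph n → (k a c₁ c₂ c₃ : ℕ) → Set
IsProperQSR3 G k a c₁ c₂ c₃ =
  IsQSR3 G k a c₁ c₂ c₃ × Realised G c₁ × Realised G c₂ × Realised G c₃

Distinct4 : ℕ → ℕ → ℕ → ℕ → Set
Distinct4 a b c d = ¬ a ≡ b × ¬ a ≡ c × ¬ a ≡ d × ¬ b ≡ c × ¬ b ≡ d × ¬ c ≡ d

IsSQSR3 : ∀ {n} → SimpleGraph n → (k a c₁ c₂ c₃ : ℕ) → Set
IsSQSR3 G k a c₁ c₂ c₃ = IsProperQSR3 G k a c₁ c₂ c₃ × Distinct4 a c₁ c₂ c₃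

{-# OPTIONS --safe #-}
module Submission where

-- Take non-adjacent u, v with k − 3 ≥ 1 common neighbours, and let w be one of them.
-- Since v has fewer common neighbours with u than neighbours, some neighbour x of v
-- is not adjacent to u. As G is triangle-free (a = 0), N(u) and N(w) are disjoint, so
-- N(u) ∪ N(w) has 2k vertices, and x lies outside it: x ∉ N(w) because v would be a
-- common neighbour of the adjacent vertices w and x. Hence n ≥ 2k + 1.

open import Defs
open import Data.Nat using (ℕ; suc; _+_; _∸_; _≤_; _<_; s≤s; z≤n)
open import Data.Nat.Properties
  using ( ≤-trans; +-suc; +-comm; +-identityʳ; <⇒≱; m<n⇒n≢0
        ; ∸-monoˡ-≤; ∸-monoʳ-<; m+n≤o⇒n≤o; m+n≤o⇒m≤o∸n)
open import Data.Bool using (true; false)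
open import Data.Fin using (Fin)
open import Data.Fin.Subset
  using (Subset; Nonempty; Empty; ∁; _∈_; _∉_; _⊆_; _∪_; _∩_; ∣_∣)
open import Data.Fin.Subset.Properties
  using ( ∩-comm; nonempty?; Empty-unique; ∈⊤; _∈?_
        ; ∣p∣≤∣x∷p∣; ∣⊥∣≡0; ∣⊤∣≡n; p⊂q⇒∣p∣<∣q∣; p⊆q⇒∣p∣≤∣q∣
        ; x∈p∩q⁺; x∈p∩q⁻; x∈p∪q⁻; x∉p⇒x∈∁p; x∈∁p⇒x∉p)
open import Data.Vec using (_∷_; []; here; there)
open import Data.Vec.Properties using (lookup∘tabulate; []=⇒lookup; lookup⇒[]=)
open import Data.Product using (∃; _×_; _,_; proj₁; proj₂)
open import Data.Sum using (inj₁; inj₂)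
open import Relation.Nullary using (¬_; yes; no; does; proof; contradiction)
open import Relation.Nullary.Decidable using (dec-true)
open import Relation.Nullary.Reflects using (Reflects; invert)
open import Relation.Binary.PropositionalEquality
  using (_≡_; refl; sym; trans; cong; subst; subst₂; module ≡-Reasoning)

private
  variable
    n : ℕ

∣p∪q∣+∣p∩q∣≡∣p∣+∣q∣ : (p q : Subset n) → ∣ p ∪ q ∣ + ∣ p ∩ q ∣ ≡ ∣ p ∣ + ∣ q ∣
∣p∪q∣+∣p∩q∣≡∣p∣+∣q∣ [] [] = refl
∣p∪q∣+∣p∩q∣≡∣p∣+∣q∣ (true ∷ p) (true ∷ q) =
  cong suc (trans (+-suc ∣ p ∪ q ∣ ∣ p ∩ q ∣)
                  (trans (cong suc (∣p∪q∣+∣p∩q∣≡∣p∣+∣q∣ p q)) (sym (+-suc ∣ p ∣ ∣ q ∣))))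
∣p∪q∣+∣p∩q∣≡∣p∣+∣q∣ (true ∷ p) (false ∷ q) = cong suc (∣p∪q∣+∣p∩q∣≡∣p∣+∣q∣ p q)
∣p∪q∣+∣p∩q∣≡∣p∣+∣q∣ (false ∷ p) (true ∷ q) =
  trans (cong suc (∣p∪q∣+∣p∩q∣≡∣p∣+∣q∣ p q)) (sym (+-suc ∣ p ∣ ∣ q ∣))
∣p∪q∣+∣p∩q∣≡∣p∣+∣q∣ (false ∷ p) (false ∷ q) = ∣p∪q∣+∣p∩q∣≡∣p∣+∣q∣ p q

Empty⇒∣p∣≡0 : {p : Subset n} → Empty p → ∣ p ∣ ≡ 0
Empty⇒∣p∣≡0 {n = n} e rewrite Empty-unique e = ∣⊥∣≡0 n

∣p∣>0⇒Nonempty : (p : Subset n) → 0 < ∣ p ∣ → Nonempty p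
∣p∣>0⇒Nonempty p ∣p∣>0 with nonempty? p
... | yes ne = ne
... | no e   = contradiction (Empty⇒∣p∣≡0 e) (m<n⇒n≢0 ∣p∣>0)

x∉p⇒∣p∣<n : {x : Fin n} {p : Subset n} → x ∉ p → ∣ p ∣ < n
x∉p⇒∣p∣<n {x = x} {p = p} x∉p = subst (∣ p ∣ <_) (∣⊤∣≡n _) (p⊂q⇒∣p∣<∣q∣ ((λ _ → ∈⊤) , x , ∈⊤ , x∉p))

∣p∩q∣<∣p∣⇒∃∈p∉q : (p q : Subset n) → ∣ p ∩ q ∣ < ∣ p ∣ → ∃ λ x → x ∈ p × x ∉ q
∣p∩q∣<∣p∣⇒∃∈p∉q p q ∣p∩q∣<∣p∣ with nonempty? (p ∩ ∁ q)
... | yes (x , x∈p∩∁q) = x , x∈p , x∈∁p⇒x∉p x∈∁q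
  where
  x∈p : x ∈ p
  x∈p = proj₁ (x∈p∩q⁻ p (∁ q) x∈p∩∁q)
  x∈∁q : x ∈ ∁ q
  x∈∁q = proj₂ (x∈p∩q⁻ p (∁ q) x∈p∩∁q)
... | no ∄x = contradiction (p⊆q⇒∣p∣≤∣q∣ p⊆p∩q) (<⇒≱ ∣p∩q∣<∣p∣)
  where
  p⊆p∩q : p ⊆ p ∩ q
  p⊆p∩q {x} x∈p with x ∈? q
  ... | yes x∈q = x∈p∩q⁺ (x∈p , x∈q)
  ... | no  x∉q = contradiction (x , x∈p∩q⁺ (x∈p , x∉p⇒x∈∁p x∉q)) ∄x

x∈p⇒∣p∣>0 : {x : Fin n} {p : Subset n} → x ∈ p → 0 < ∣ p ∣
x∈p⇒∣p∣>0 here = s≤s z≤n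
x∈p⇒∣p∣>0 {p = s ∷ p} (there x∈p) = ≤-trans (x∈p⇒∣p∣>0 x∈p) (∣p∣≤∣x∷p∣ s p)

TriangleFree : ∀ {n} → SimpleGraph n → Set
TriangleFree G = ∀ u v → Adj G u v → commonNbrs G u v ≡ 0

module _ {n : ℕ} (G : SimpleGraph n) where

  Adj⇒∈nbhd : ∀ {u v} → Adj G u v → v ∈ nbhd G u
  Adj⇒∈nbhd {u} {v} uv =
    lookup⇒[]= v (nbhd G u) (trans (lookup∘tabulate _ v) (dec-true (adj? G u v) uv))

  ∈nbhd⇒Adj : ∀ {u v} → v ∈ nbhd G u → Adj G u v
  ∈nbhd⇒Adj {u} {v} v∈ = invert (subst (Reflects (Adj G u v)) does≡true (proof (adj? G u v)))
    where
    does≡true : does (adj? G u v) ≡ true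
    does≡true = trans (sym (lookup∘tabulate _ v)) ([]=⇒lookup v∈)

  commonNbrs-comm : ∀ u v → commonNbrs G u v ≡ commonNbrs G v u
  commonNbrs-comm u v = cong ∣_∣ (∩-comm (nbhd G u) (nbhd G v))

  module _ (triangleFree : TriangleFree G) where

    triangleFree⇒¬Adj : ∀ {v w x} → Adj G v w → Adj G v x → ¬ Adj G w x
    triangleFree⇒¬Adj vw vx wx =
      m<n⇒n≢0 (x∈p⇒∣p∣>0 (x∈p∩q⁺ (Adj⇒∈nbhd (symm G vw) , Adj⇒∈nbhd (symm G vx))))
              (triangleFree _ _ wx)

    triangleFree⇒∣nbhd∪nbhd∣ : ∀ {u w} → Adj G u w →
      ∣ nbhd G u ∪ nbhd G w ∣ ≡ degree G u + degree G w
    triangleFree⇒∣nbhd∪nbhd∣ {u} {w} uw = begin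
      ∣ N u ∪ N w ∣                ≡⟨ sym (+-identityʳ _) ⟩
      ∣ N u ∪ N w ∣ + 0            ≡⟨ cong (∣ N u ∪ N w ∣ +_) (sym (triangleFree u w uw)) ⟩
      ∣ N u ∪ N w ∣ + ∣ N u ∩ N w ∣ ≡⟨ ∣p∪q∣+∣p∩q∣≡∣p∣+∣q∣ (N u) (N w) ⟩
      ∣ N u ∣ + ∣ N w ∣            ∎
      where
      open ≡-Reasoning
      N = nbhd G

    triangleFree⇒degree+degree<n : ∀ {u v w} → Adj G u w → Adj G v w →
      commonNbrs G u v < degree G v → degree G u + degree G w < n
    triangleFree⇒degree+degree<n {u} {v} {w} uw vw c<d
      with ∣p∩q∣<∣p∣⇒∃∈p∉q (nbhd G v) (nbhd G u) (subst (_< degree G v) (commonNbrs-comm u v) c<d)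
    ... | x , x∈Nv , x∉Nu =
      subst (_< n) (triangleFree⇒∣nbhd∪nbhd∣ uw) (x∉p⇒∣p∣<n x∉Nu∪Nw)
      where
      x∉Nu∪Nw : x ∉ nbhd G u ∪ nbhd G w
      x∉Nu∪Nw x∈ with x∈p∪q⁻ (nbhd G u) (nbhd G w) x∈
      ... | inj₁ x∈Nu = x∉Nu x∈Nu
      ... | inj₂ x∈Nw = triangleFree⇒¬Adj (symm G vw) (∈nbhd⇒Adj x∈Nw) (∈nbhd⇒Adj x∈Nv)

m+m<n⇒m≤n∸m∸1 : ∀ {m n} → m + m < n → m ≤ n ∸ m ∸ 1
m+m<n⇒m≤n∸m∸1 {m} {n} m+m<n =
  m+n≤o⇒m≤o∸n m (m+n≤o⇒m≤o∸n (m + 1) (subst (λ i → i + m ≤ n) (+-comm 1 m) m+m<n))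

mainTheorem10 : (n k : ℕ) → 4 ≤ k → (G : SimpleGraph n) →
    IsSQSR3 G k 0 (k ∸ 1) (k ∸ 2) (k ∸ 3) → k ≤ n ∸ k ∸ 1
mainTheorem10 n k k≥4 G (((regular , triangleFree , _) , _ , _ , (u , v , _ , c≡k∸3)) , _) =
  m+m<n⇒m≤n∸m∸1 (subst₂ (λ du dw → du + dw < n) (regular u) (regular w)
    (triangleFree⇒degree+degree<n G triangleFree (∈nbhd⇒Adj G w∈Nu) (∈nbhd⇒Adj G w∈Nv) c<dv))
  where
  c<dv : commonNbrs G u v < degree G v
  c<dv = subst₂ _<_ (sym c≡k∸3) (sym (regular v)) (∸-monoʳ-< {k} {3} {0} (s≤s z≤n) (m+n≤o⇒n≤o 1 k≥4))

  commonNbr : Nonempty (nbhd G u ∩ nbhd G v)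
  commonNbr = ∣p∣>0⇒Nonempty _ (subst (0 <_) (sym c≡k∸3) (∸-monoˡ-≤ 3 k≥4))

  w : Fin n
  w = proj₁ commonNbr

  w∈Nu : w ∈ nbhd G u
  w∈Nu = proj₁ (x∈p∩q⁻ (nbhd G u) (nbhd G v) (proj₂ commonNbr))

  w∈Nv : w ∈ nbhd G v
  w∈Nv = proj₂ (x∈p∩q⁻ (nbhd G u) (nbhd G v) (proj₂ commonNbr))
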